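{- Let $n$ be a positive integer and let $F=q(n;m_1;m_2;\dots;m_l)=\binom{[n]}{m_1}\cup\binom{[m_1-1]}{m_2}\cup\cdots\cup\binom{[m_{l-1}-1]}{m_l}$ for some positive integers $n\ge m_1>m_2>\cdots>m_l=1$. Then $F$ is a maximal union-free family of non-empty subsets of $[n]$: for every non-empty $S\subseteq[n]$ with $S\notin F$, the family $F\cup\{S\}$ is not union-free.
   Context: $[n]=\{1,\dots,n\}$; $\binom{S}{k}$ is the family of $k$-element subsets of $S$. A finite family of sets is union-free if no member equals the union of one or more other members of the family. -}

module Defs where

open import Data.Nat using (ℕ; zero; suc; _≤_; _<_; _>_; _∸_)
open import Data.Fin using (Fin; zero; suc; toℕ; inject₁; fromℕ)
open import Data.Fin.Subset using (Subset; _∈_; ∣_∣; ⋃; Nonempty)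
open import Data.List using (List; [])
open import Data.List.Relation.Unary.All using (All)
open import Data.Product using (Σ; _×_)
open import Data.Sum using (_⊎_)
open import Relation.Binary.PropositionalEquality using (_≡_; _≢_)

Family : ℕ → Set₁
Family n = Subset n → Set

UnionFree : ∀ {n} → Family n → Set
UnionFree {n} F = ∀ (A : Subset n) → F A →
  ∀ (Bs : List (Subset n)) → Bs ≢ [] →
  All (λ B → F B × B ≢ A) Bs → ⋃ Bs ≢ A

insert : ∀ {n} → Family n → Subset n → Family n
insert F S T = F T ⊎ T ≡ S

-- Valid parameter sequence m₁ > m₂ > ⋯ > m_l = 1 with n ≥ m₁,
-- encoded as m : Fin (suc k) → ℕ with l = k + 1, m zero = m₁.
ValidSeq : (n k : ℕ) → (Fin (suc k) → ℕ) → Set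
ValidSeq n k m =
  (m zero ≤ n) ×
  ((i : Fin k) → m (inject₁ i) > m (suc i)) ×
  (m (fromℕ k) ≡ 1)

-- q(n; m₁; …; m_l) = C([n], m₁) ∪ C([m₁-1], m₂) ∪ ⋯ ∪ C([m_{l-1}-1], m_l).
-- Element x : Fin n stands for the integer toℕ x + 1 ∈ [n];
-- x ∈ [m-1] iff toℕ x + 1 ≤ m ∸ 1.
q : (n k : ℕ) → (Fin (suc k) → ℕ) → Family n
q n k m S =
  (∣ S ∣ ≡ m zero) ⊎
  Σ (Fin k) (λ i → (∣ S ∣ ≡ m (suc i)) ×
                   (∀ x → x ∈ S → suc (toℕ x) ≤ m (inject₁ i) ∸ 1))

module Submission where

-- q(n; m₁; …; m_l) is the union of the layers C([b_j], m_j) with b₁ = n and b_{j+1} = m_j - 1.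
--
-- Union-free: the members whose union is a member A of layer j are proper subsets of A,
-- hence smaller, hence in later layers, hence inside [m_j - 1]; but then so is A, which
-- is impossible for |A| = m_j.
--
-- Maximal: let M = max S. The intervals [m_j, b_j] cover [1, n], so M lies in one of them
-- and S ⊆ [b_j]. If |S| > m_j, S is the union of its m_j-subsets, all in layer j. If
-- |S| < m_j, add the smallest elements of [M] to S until it has m_j elements; the result A
-- is in layer j and is the union of S with, for each added y, a member of q inside [y]
-- containing y (chosen from the layer of y), none of which contains M.

open import Defs
open import Data.Bool using (_∨_; _∧_)
open import Data.Nat using (ℕ; zero; suc; _≤_; _<_; _>_; _∸_; _⊓_; z≤n; s≤s; _≤?_)
open import Data.Nat.Properties
  using (≤-refl; ≤-trans; ≤-antisym; <⇒≤; <⇒≱; <⇒≢; ≤-pred; n≤1+n;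
         m≤n⇒m<n∨m≡n; ≰⇒>; ∸-monoˡ-≤; m⊓n≤n; m≥n⇒m⊓n≡n; ⊓-zeroʳ; <-cmp)
open import Data.Fin using (Fin; zero; suc; toℕ; inject₁; fromℕ)
open import Data.Fin.Properties using (toℕ<n; toℕ-injective; any?)
open import Data.Fin.Subset
  using (Subset; inside; outside; _∈_; _⊆_; _⊂_; ∣_∣; ⋃; _∪_; _∩_; ⊥; ⊤; ⁅_⁆; Nonempty)
open import Data.Fin.Subset.Properties
  using (⊆-antisym; p⊆q⇒∣p∣≤∣q∣; p⊂q⇒∣p∣<∣q∣; p⊆p∪q; q⊆p∪q; x∈p∪q⁻; x∈p∩q⁺; x∈p∩q⁻;
         ∣p∣≤∣x∷p∣; ∣⁅x⁆∣≡1; x∈⁅x⁆; x∈⁅y⁆⇒x≡y; ∉⊥; ∣⊥∣≡0; Empty-unique; nonempty?; _∈?_;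
         ∪-identityʳ; ∩-zeroʳ; ∩-identityʳ)
open import Data.Vec using ([]; _∷_; here; there)
open import Data.List using (List; tabulate)
import Data.List.Relation.Unary.All as All
open import Data.List.Relation.Unary.All using (All; lookup)
open import Data.List.Relation.Unary.All.Properties using (tabulate⁺)
import Data.List.Relation.Unary.Any as Any
import Data.List.Membership.Propositional as List
open import Data.List.Membership.Propositional.Properties using (∈-tabulate⁺)
open import Data.Product using (∃-syntax; _×_; _,_; proj₁; proj₂)
open import Data.Sum using (inj₁; inj₂; [_,_])
open import Function using (_∘_; id)
open import Relation.Nullary using (¬_; yes; no; contradiction)
open import Relation.Nullary.Decidable using (decidable-stable; ¬?; _×-dec_)
open import Relation.Binary.Definitions using (tri<; tri≈; tri>)
open import Relation.Binary.PropositionalEquality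
  using (_≡_; _≢_; refl; sym; trans; cong; subst; subst₂; module ≡-Reasoning)

private
  variable
    n : ℕ

m<n⇒m≤n∸1 : ∀ {m n} → m < n → m ≤ n ∸ 1
m<n⇒m≤n∸1 (s≤s m≤n) = m≤n

n∸1<n : ∀ {n} → 1 ≤ n → n ∸ 1 < n
n∸1<n {suc n} _ = ≤-refl

intermediate-value : (f : ℕ → ℕ) → (∀ c → f (suc c) ≤ suc (f c)) →
                     ∀ {t} N → f 0 ≤ t → t ≤ f N → ∃[ c ] f c ≡ t
intermediate-value f step zero    f0≤t t≤fN = 0 , ≤-antisym f0≤t t≤fN
intermediate-value f step (suc N) f0≤t t≤fN with m≤n⇒m<n∨m≡n t≤fN
... | inj₂ t≡fN = suc N , sym t≡fN
... | inj₁ t<fN = intermediate-value f step N f0≤t (≤-pred (≤-trans t<fN (step N)))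

∣p∣>0⇒Nonempty : {p : Subset n} → 0 < ∣ p ∣ → Nonempty p
∣p∣>0⇒Nonempty {n} {p} 0<∣p∣ = decidable-stable (nonempty? p) λ p-empty →
  contradiction (subst (0 <_) (trans (cong ∣_∣ (Empty-unique p-empty)) (∣⊥∣≡0 n)) 0<∣p∣) λ ()

p⊆q⇒p∪q≡q : {p q : Subset n} → p ⊆ q → p ∪ q ≡ q
p⊆q⇒p∪q≡q {p = p} {q} p⊆q = ⊆-antisym (λ x∈ → [ p⊆q , id ] (x∈p∪q⁻ p q x∈)) (q⊆p∪q p q)

p⊆q⇒p∪[q∩r]⊆q : {p q r : Subset n} → p ⊆ q → p ∪ (q ∩ r) ⊆ q
p⊆q⇒p∪[q∩r]⊆q {p = p} {q} {r} p⊆q x∈ = [ p⊆q , proj₁ ∘ x∈p∩q⁻ q r ] (x∈p∪q⁻ p (q ∩ r) x∈)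

p⊆q∧p≢q⇒p⊂q : {p q : Subset n} → p ⊆ q → p ≢ q → p ⊂ q
p⊆q∧p≢q⇒p⊂q {p = p} {q} p⊆q p≢q with any? (λ x → x ∈? q ×-dec ¬? (x ∈? p))
... | yes (x , x∈q , x∉p) = p⊆q , x , x∈q , x∉p
... | no ∄ = contradiction (⊆-antisym p⊆q q⊆p) p≢q
  where
  q⊆p : q ⊆ p
  q⊆p {x} x∈q = decidable-stable (x ∈? p) λ x∉p → ∄ (x , x∈q , x∉p)

∣p∣<∣q∣⇒p≢q : {p q : Subset n} → ∣ p ∣ < ∣ q ∣ → p ≢ q
∣p∣<∣q∣⇒p≢q ∣p∣<∣q∣ p≡q = <⇒≢ ∣p∣<∣q∣ (cong ∣_∣ p≡q)

⁅x⁆⊆p : {p : Subset n} {x : Fin n} → x ∈ p → ⁅ x ⁆ ⊆ p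
⁅x⁆⊆p {p = p} {x} x∈p y∈⁅x⁆ = subst (_∈ p) (sym (x∈⁅y⁆⇒x≡y x y∈⁅x⁆)) x∈p

below : ℕ → Subset n
below {zero}  c       = []
below {suc n} zero    = outside ∷ below zero
below {suc n} (suc c) = inside ∷ below c

∈below⁺ : ∀ {c} {x : Fin n} → toℕ x < c → x ∈ below c
∈below⁺ {suc n} {suc c} {zero}  _         = here
∈below⁺ {suc n} {suc c} {suc x} (s≤s x<c) = there (∈below⁺ x<c)

∈below⁻ : ∀ {c} {x : Fin n} → x ∈ below c → toℕ x < c
∈below⁻ {suc n} {zero}  (there x∈) = contradiction (∈below⁻ x∈) λ ()
∈below⁻ {suc n} {suc c} here       = s≤s z≤n
∈below⁻ {suc n} {suc c} (there x∈) = s≤s (∈below⁻ x∈)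

below-mono : ∀ {c d} → c ≤ d → below {n} c ⊆ below d
below-mono c≤d x∈ = ∈below⁺ (≤-trans (∈below⁻ x∈) c≤d)

below-zero : below {n} 0 ≡ ⊥
below-zero {zero}  = refl
below-zero {suc n} = cong (outside ∷_) below-zero

below-n : below {n} n ≡ ⊤
below-n {zero}  = refl
below-n {suc n} = cong (inside ∷_) below-n

∣below∣≡n⊓c : ∀ n c → ∣ below {n} c ∣ ≡ n ⊓ c
∣below∣≡n⊓c zero    c       = refl
∣below∣≡n⊓c (suc n) zero    = trans (∣below∣≡n⊓c n zero) (⊓-zeroʳ n)
∣below∣≡n⊓c (suc n) (suc c) = cong suc (∣below∣≡n⊓c n c)

∣below∣≡c : ∀ {c} → c ≤ n → ∣ below {n} c ∣ ≡ c
∣below∣≡c {n} {c} c≤n = trans (∣below∣≡n⊓c n c) (m≥n⇒m⊓n≡n c≤n)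

p⊆below⇒∣p∣≤ : ∀ {c} {p : Subset n} → p ⊆ below c → ∣ p ∣ ≤ c
p⊆below⇒∣p∣≤ {n} {c} p⊆ =
  ≤-trans (p⊆q⇒∣p∣≤∣q∣ p⊆) (subst (_≤ c) (sym (∣below∣≡n⊓c n c)) (m⊓n≤n n c))

maximum : {p : Subset n} → Nonempty p → ∃[ M ] M ∈ p × p ⊆ below (suc (toℕ M))
maximum {p = x ∷ p} p≠∅ with nonempty? p
... | yes p′≠∅ = let M , M∈p , p⊆ = maximum p′≠∅ in
  suc M , there M∈p , λ { here → here ; (there y∈p) → there (p⊆ y∈p) }
maximum {p = inside ∷ p} _ | no p′=∅ =
  zero , here , λ { here → here ; (there y∈p) → contradiction (_ , y∈p) p′=∅ }
maximum {p = outside ∷ p} (suc y , there y∈p) | no p′=∅ = contradiction (y , y∈p) p′=∅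

∣x∷p∣≤1+∣p∣ : ∀ x (p : Subset n) → ∣ x ∷ p ∣ ≤ suc ∣ p ∣
∣x∷p∣≤1+∣p∣ inside  p = ≤-refl
∣x∷p∣≤1+∣p∣ outside p = n≤1+n ∣ p ∣

∣x∷p∣≤1+∣x∷q∣ : ∀ x (p q : Subset n) → ∣ p ∣ ≤ suc ∣ q ∣ → ∣ x ∷ p ∣ ≤ suc ∣ x ∷ q ∣
∣x∷p∣≤1+∣x∷q∣ inside  _ _ ∣p∣≤1+∣q∣ = s≤s ∣p∣≤1+∣q∣
∣x∷p∣≤1+∣x∷q∣ outside _ _ ∣p∣≤1+∣q∣ = ∣p∣≤1+∣q∣

∣p∪[q∩below]∣-step : ∀ (p q : Subset n) c →
                     ∣ p ∪ (q ∩ below (suc c)) ∣ ≤ suc ∣ p ∪ (q ∩ below c) ∣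
∣p∪[q∩below]∣-step []      []      c       = z≤n
∣p∪[q∩below]∣-step (x ∷ p) (y ∷ q) zero    =
  ≤-trans (∣x∷p∣≤1+∣p∣ (x ∨ (y ∧ inside)) rest) (s≤s (∣p∣≤∣x∷p∣ (x ∨ (y ∧ outside)) rest))
  where rest = p ∪ (q ∩ below 0)
∣p∪[q∩below]∣-step (x ∷ p) (y ∷ q) (suc c) =
  ∣x∷p∣≤1+∣x∷q∣ (x ∨ (y ∧ inside)) (p ∪ (q ∩ below (suc c))) (p ∪ (q ∩ below c)) (∣p∪[q∩below]∣-step p q c)

-- Adding the elements of q to p in increasing order reaches every size in between.
fill : {p q : Subset n} {r : ℕ} → p ⊆ q → ∣ p ∣ ≤ r → r ≤ ∣ q ∣ →
       ∃[ c ] ∣ p ∪ (q ∩ below c) ∣ ≡ r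
fill {n} {p} {q} p⊆q ∣p∣≤r r≤∣q∣ =
  intermediate-value (λ c → ∣ p ∪ (q ∩ below c) ∣) (∣p∪[q∩below]∣-step p q) n
    (subst (_≤ _) (sym start) ∣p∣≤r) (subst (_ ≤_) (sym end) r≤∣q∣)
  where
  open ≡-Reasoning
  start : ∣ p ∪ (q ∩ below 0) ∣ ≡ ∣ p ∣
  start = begin
    ∣ p ∪ (q ∩ below 0) ∣ ≡⟨ cong (λ b → ∣ p ∪ (q ∩ b) ∣) below-zero ⟩
    ∣ p ∪ (q ∩ ⊥) ∣       ≡⟨ cong (λ s → ∣ p ∪ s ∣) (∩-zeroʳ q) ⟩
    ∣ p ∪ ⊥ ∣             ≡⟨ cong ∣_∣ (∪-identityʳ p) ⟩
    ∣ p ∣                 ∎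
  end : ∣ p ∪ (q ∩ below n) ∣ ≡ ∣ q ∣
  end = begin
    ∣ p ∪ (q ∩ below n) ∣ ≡⟨ cong (λ b → ∣ p ∪ (q ∩ b) ∣) below-n ⟩
    ∣ p ∪ (q ∩ ⊤) ∣       ≡⟨ cong (λ s → ∣ p ∪ s ∣) (∩-identityʳ q) ⟩
    ∣ p ∪ q ∣             ≡⟨ cong ∣_∣ (p⊆q⇒p∪q≡q p⊆q) ⟩
    ∣ q ∣                 ∎

subset-containing-of-size : {p : Subset n} {x : Fin n} {r : ℕ} → x ∈ p → 1 ≤ r → r ≤ ∣ p ∣ →
                            ∃[ Z ] x ∈ Z × Z ⊆ p × ∣ Z ∣ ≡ r
subset-containing-of-size {x = x} x∈p 1≤r r≤∣p∣ =
  let c , ∣Z∣≡r = fill (⁅x⁆⊆p x∈p) (subst (_≤ _) (sym (∣⁅x⁆∣≡1 x)) 1≤r) r≤∣p∣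
  in _ , p⊆p∪q _ (x∈⁅x⁆ x) , p⊆q⇒p∪[q∩r]⊆q (⁅x⁆⊆p x∈p) , ∣Z∣≡r

B∈Bs⇒B⊆⋃Bs : ∀ {B : Subset n} {Bs} → B List.∈ Bs → B ⊆ ⋃ Bs
B∈Bs⇒B⊆⋃Bs (Any.here refl) = p⊆p∪q _
B∈Bs⇒B⊆⋃Bs (Any.there B∈)  = q⊆p∪q _ _ ∘ B∈Bs⇒B⊆⋃Bs B∈

⋃-least : ∀ {A : Subset n} {Bs} → All (_⊆ A) Bs → ⋃ Bs ⊆ A
⋃-least All.[]             x∈ = contradiction x∈ ∉⊥
⋃-least (B⊆A All.∷ Bs⊆A) x∈ = [ B⊆A , ⋃-least Bs⊆A ] (x∈p∪q⁻ _ _ x∈)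

Decomposable : Family n → Subset n → Set
Decomposable {n} G A = ∀ {x} → x ∈ A → ∃[ Z ] G Z × Z ⊆ A × Z ≢ A × x ∈ Z

decomposable⇒¬UnionFree : {G : Family n} {A : Subset n} →
                          G A → Nonempty A → Decomposable G A → ¬ UnionFree G
decomposable⇒¬UnionFree {zero} _ (() , _)
decomposable⇒¬UnionFree {suc n} {G} {A} GA (a , a∈A) decompose unionFree =
  unionFree A GA (tabulate piece) (λ ())
    (tabulate⁺ λ x → piece∈G x , piece≢A x)
    (⊆-antisym (⋃-least (tabulate⁺ piece⊆A))
               (λ {x} x∈A → B∈Bs⇒B⊆⋃Bs (∈-tabulate⁺ {f = piece} x) (x∈piece x x∈A)))
  where
  piece′ : ∀ x → ∃[ Z ] G Z × Z ⊆ A × Z ≢ A × (x ∈ A → x ∈ Z)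
  piece′ x with x ∈? A
  ... | yes x∈A = let Z , GZ , Z⊆A , Z≢A , x∈Z = decompose x∈A in Z , GZ , Z⊆A , Z≢A , λ _ → x∈Z
  ... | no  x∉A = let Z , GZ , Z⊆A , Z≢A , _ = decompose a∈A in
    Z , GZ , Z⊆A , Z≢A , λ x∈A → contradiction x∈A x∉A
  piece : Fin (suc n) → Subset (suc n)
  piece = proj₁ ∘ piece′
  piece∈G : ∀ x → G (piece x)
  piece∈G = proj₁ ∘ proj₂ ∘ piece′
  piece⊆A : ∀ x → piece x ⊆ A
  piece⊆A = proj₁ ∘ proj₂ ∘ proj₂ ∘ piece′
  piece≢A : ∀ x → piece x ≢ A
  piece≢A = proj₁ ∘ proj₂ ∘ proj₂ ∘ proj₂ ∘ piece′
  x∈piece : ∀ x → x ∈ A → x ∈ piece x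
  x∈piece = proj₂ ∘ proj₂ ∘ proj₂ ∘ proj₂ ∘ piece′

StrictlyDecreasing : ∀ k → (Fin (suc k) → ℕ) → Set
StrictlyDecreasing k m = (i : Fin k) → m (inject₁ i) > m (suc i)

head-maximal : ∀ {k} m → StrictlyDecreasing k m → ∀ j → m j ≤ m zero
head-maximal         m decreasing zero    = ≤-refl
head-maximal {suc k} m decreasing (suc j) =
  ≤-trans (head-maximal (m ∘ suc) (decreasing ∘ suc) j) (<⇒≤ (decreasing zero))

last-minimal : ∀ {k} m → StrictlyDecreasing k m → ∀ j → m (fromℕ k) ≤ m j
last-minimal {zero}  m decreasing zero    = ≤-refl
last-minimal {suc k} m decreasing zero    =
  ≤-trans (last-minimal (m ∘ suc) (decreasing ∘ suc) zero) (<⇒≤ (decreasing zero))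
last-minimal {suc k} m decreasing (suc j) = last-minimal (m ∘ suc) (decreasing ∘ suc) j

-- The b of the layer C([b], m j) of q: top for j = 0 and m (j - 1) ∸ 1 otherwise (ground-suc);
-- recursing on the tail of m keeps ground-< and band structural.
ground : ∀ {k} → ℕ → (Fin (suc k) → ℕ) → Fin (suc k) → ℕ
ground         top m zero    = top
ground {suc k} top m (suc i) = ground (m zero ∸ 1) (m ∘ suc) i

ground-suc : ∀ {k} top m (i : Fin k) → ground top m (suc i) ≡ m (inject₁ i) ∸ 1
ground-suc top m zero    = refl
ground-suc top m (suc i) = ground-suc (m zero ∸ 1) (m ∘ suc) i

ground-< : ∀ {k} m → StrictlyDecreasing k m →
           ∀ top j j′ → m j′ < m j → ground top m j′ ≤ m j ∸ 1
ground-<         m decreasing top j       zero     m₀<mⱼ =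
  contradiction (head-maximal m decreasing j) (<⇒≱ m₀<mⱼ)
ground-< {suc k} m decreasing top zero    (suc i)  _     =
  subst (_≤ m zero ∸ 1) (sym (ground-suc top m i)) (∸-monoˡ-≤ 1 (head-maximal m decreasing (inject₁ i)))
ground-< {suc k} m decreasing top (suc i) (suc i′) mⱼ′<mⱼ =
  ground-< (m ∘ suc) (decreasing ∘ suc) (m zero ∸ 1) i i′ mⱼ′<mⱼ

band : ∀ {k} m → StrictlyDecreasing k m → ∀ {top v} → m (fromℕ k) ≤ v → v ≤ top →
       ∃[ j ] m j ≤ v × v ≤ ground top m j
band m decreasing {v = v} mₗ≤v v≤top with m zero ≤? v
... | yes m₀≤v = zero , m₀≤v , v≤top
band {zero}  m decreasing mₗ≤v _ | no m₀≰v = contradiction mₗ≤v m₀≰v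
band {suc k} m decreasing mₗ≤v _ | no m₀≰v =
  let j , mⱼ≤v , v≤bⱼ = band (m ∘ suc) (decreasing ∘ suc) mₗ≤v (m<n⇒m≤n∸1 (≰⇒> m₀≰v)) in
  suc j , mⱼ≤v , v≤bⱼ

-- The family C([b], r), with [b] read as {x | toℕ x < b}.
Binomial : ℕ → ℕ → Family n
Binomial b r S = S ⊆ below b × ∣ S ∣ ≡ r

module _ {n k : ℕ} {m : Fin (suc k) → ℕ} where

  q⇒Binomial : {S : Subset n} → q n k m S → ∃[ j ] Binomial (ground n m j) (m j) S
  q⇒Binomial (inj₁ ∣S∣≡m₀) = zero , (λ {x} _ → ∈below⁺ (toℕ<n x)) , ∣S∣≡m₀
  q⇒Binomial (inj₂ (i , ∣S∣≡mᵢ , S<)) =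
    suc i , (λ {x} x∈S → ∈below⁺ (subst (toℕ x <_) (sym (ground-suc n m i)) (S< x x∈S))) , ∣S∣≡mᵢ

  Binomial⇒q : {S : Subset n} (j : Fin (suc k)) → Binomial (ground n m j) (m j) S → q n k m S
  Binomial⇒q zero    (_ , ∣S∣≡m₀)    = inj₁ ∣S∣≡m₀
  Binomial⇒q (suc i) (S⊆bᵢ , ∣S∣≡mᵢ) =
    inj₂ (i , ∣S∣≡mᵢ , λ x x∈S → subst (toℕ x <_) (ground-suc n m i) (∈below⁻ (S⊆bᵢ x∈S)))

  module _ (valid : ValidSeq n k m) where

    private
      decreasing : StrictlyDecreasing k m
      decreasing = proj₁ (proj₂ valid)

      1≤m : ∀ j → 1 ≤ m j
      1≤m j = subst (_≤ m j) (proj₂ (proj₂ valid)) (last-minimal m decreasing j)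

      band-of : (x : Fin n) → ∃[ j ] m j ≤ suc (toℕ x) × suc (toℕ x) ≤ ground n m j
      band-of x = band m decreasing (subst (_≤ suc (toℕ x)) (sym (proj₂ (proj₂ valid))) (s≤s z≤n)) (toℕ<n x)

    q-nonempty : ∀ S → q n k m S → Nonempty S
    q-nonempty S qS = let j , _ , ∣S∣≡mⱼ = q⇒Binomial qS in
      ∣p∣>0⇒Nonempty (subst (1 ≤_) (sym ∣S∣≡mⱼ) (1≤m j))

    proper-subset-below : ∀ {j} {A B : Subset n} → ∣ A ∣ ≡ m j →
                          q n k m B → B ⊆ A → B ≢ A → B ⊆ below (m j ∸ 1)
    proper-subset-below {j} {A} {B} ∣A∣≡mⱼ qB B⊆A B≢A =
      let j′ , B⊆bⱼ′ , ∣B∣≡mⱼ′ = q⇒Binomial qB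
          mⱼ′<mⱼ = subst₂ _<_ ∣B∣≡mⱼ′ ∣A∣≡mⱼ (p⊂q⇒∣p∣<∣q∣ (p⊆q∧p≢q⇒p⊂q B⊆A B≢A))
      in below-mono (ground-< m decreasing n j j′ mⱼ′<mⱼ) ∘ B⊆bⱼ′

    q-unionFree : UnionFree (q n k m)
    q-unionFree A qA Bs _ members ⋃Bs≡A with q⇒Binomial qA
    ... | j , _ , ∣A∣≡mⱼ =
      <⇒≱ (n∸1<n (1≤m j)) (subst (_≤ m j ∸ 1) ∣A∣≡mⱼ (p⊆below⇒∣p∣≤ A⊆))
      where
      Bs⊆ : All (_⊆ below (m j ∸ 1)) Bs
      Bs⊆ = All.tabulate λ B∈Bs →
        let qB , B≢A = lookup members B∈Bs
        in proper-subset-below ∣A∣≡mⱼ qB (subst (_ ⊆_) ⋃Bs≡A (B∈Bs⇒B⊆⋃Bs B∈Bs)) B≢A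
      A⊆ : A ⊆ below (m j ∸ 1)
      A⊆ = subst (_⊆ below (m j ∸ 1)) ⋃Bs≡A (⋃-least Bs⊆)

    segment-member : (y : Fin n) → ∃[ Z ] q n k m Z × Z ⊆ below (suc (toℕ y)) × y ∈ Z
    segment-member y =
      let j , mⱼ≤y+1 , y+1≤bⱼ = band-of y
          Z , y∈Z , Z⊆y+1 , ∣Z∣≡mⱼ = subset-containing-of-size (∈below⁺ {x = y} ≤-refl) (1≤m j)
                                       (subst (m j ≤_) (sym (∣below∣≡c (toℕ<n y))) mⱼ≤y+1)
      in Z , Binomial⇒q j (below-mono y+1≤bⱼ ∘ Z⊆y+1 , ∣Z∣≡mⱼ) , Z⊆y+1 , y∈Z

    large-decomposable : ∀ {j} {S : Subset n} → S ⊆ below (ground n m j) → m j < ∣ S ∣ →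
                         Decomposable (insert (q n k m) S) S
    large-decomposable {j} {S} S⊆bⱼ mⱼ<∣S∣ x∈S =
      let Z , x∈Z , Z⊆S , ∣Z∣≡mⱼ = subset-containing-of-size x∈S (1≤m j) (<⇒≤ mⱼ<∣S∣)
      in Z , inj₁ (Binomial⇒q j (S⊆bⱼ ∘ Z⊆S , ∣Z∣≡mⱼ)) , Z⊆S
           , ∣p∣<∣q∣⇒p≢q (subst (_< ∣ S ∣) (sym ∣Z∣≡mⱼ) mⱼ<∣S∣) , x∈Z

    completion-decomposable : ∀ {S : Subset n} {M c} → M ∈ S → S ⊆ below (suc (toℕ M)) →
                              let A = S ∪ (below (suc (toℕ M)) ∩ below c) in
                              S ≢ A → Decomposable (insert (q n k m) S) A
    completion-decomposable {S} {M} {c} M∈S S⊆M+1 S≢A {y} y∈A with y ∈? S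
    ... | yes y∈S = S , inj₂ refl , p⊆p∪q _ , S≢A , y∈S
    ... | no  y∉S with segment-member y
    ... | Z , qZ , Z⊆y+1 , y∈Z = Z , inj₁ qZ , Z⊆A , Z≢A , y∈Z
      where
      A = S ∪ (below (suc (toℕ M)) ∩ below c)
      y<M+1×y<c : y ∈ below (suc (toℕ M)) × y ∈ below c
      y<M+1×y<c = x∈p∩q⁻ _ _ ([ (λ y∈S → contradiction y∈S y∉S) , id ] (x∈p∪q⁻ S _ y∈A))
      Z⊆A : Z ⊆ A
      Z⊆A w∈Z = q⊆p∪q S _ (x∈p∩q⁺ ( below-mono (∈below⁻ (proj₁ y<M+1×y<c)) (Z⊆y+1 w∈Z)
                                   , below-mono (∈below⁻ (proj₂ y<M+1×y<c)) (Z⊆y+1 w∈Z)))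
      -- y ∉ S forces toℕ y < toℕ M, so Z, whose elements are at most y, misses M.
      Z≢A : Z ≢ A
      Z≢A Z≡A = y∉S (subst (_∈ S) (toℕ-injective (≤-antisym (≤-pred (∈below⁻ (Z⊆y+1 M∈Z)))
                                                            (≤-pred (∈below⁻ (proj₁ y<M+1×y<c))))) M∈S)
        where M∈Z = subst (M ∈_) (sym Z≡A) (p⊆p∪q _ M∈S)

    q-maximal : ∀ S → Nonempty S → ¬ q n k m S → ¬ UnionFree (insert (q n k m) S)
    q-maximal S S≠∅ S∉q with maximum S≠∅
    ... | M , M∈S , S⊆M+1 with band-of M
    ... | j , mⱼ≤M+1 , M+1≤bⱼ with <-cmp ∣ S ∣ (m j)
    ... | tri≈ _ ∣S∣≡mⱼ _ = contradiction (Binomial⇒q j (below-mono M+1≤bⱼ ∘ S⊆M+1 , ∣S∣≡mⱼ)) S∉q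
    ... | tri> _ _ mⱼ<∣S∣ =
      decomposable⇒¬UnionFree (inj₂ refl) S≠∅ (large-decomposable (below-mono M+1≤bⱼ ∘ S⊆M+1) mⱼ<∣S∣)
    ... | tri< ∣S∣<mⱼ _ _ =
      let c , ∣A∣≡mⱼ = fill S⊆M+1 (<⇒≤ ∣S∣<mⱼ) (subst (m j ≤_) (sym (∣below∣≡c (toℕ<n M))) mⱼ≤M+1)
          A⊆bⱼ = λ {x} → below-mono M+1≤bⱼ ∘ p⊆q⇒p∪[q∩r]⊆q {r = below c} S⊆M+1 {x}
      in decomposable⇒¬UnionFree (inj₁ (Binomial⇒q j (A⊆bⱼ , ∣A∣≡mⱼ))) (M , p⊆p∪q _ M∈S)
           (completion-decomposable M∈S S⊆M+1 (∣p∣<∣q∣⇒p≢q (subst (∣ S ∣ <_) (sym ∣A∣≡mⱼ) ∣S∣<mⱼ)))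

mainTheorem4 : (n k : ℕ) (m : Fin (suc k) → ℕ) → 1 ≤ n → ValidSeq n k m →
    (∀ S → q n k m S → Nonempty S) ×
    UnionFree (q n k m) ×
    (∀ (S : Subset n) → Nonempty S → ¬ q n k m S → ¬ UnionFree (insert (q n k m) S))
-- The hypothesis 1 ≤ n is redundant: a nonempty S already forces it.
mainTheorem4 n k m _ valid =
  q-nonempty {m = m} valid , q-unionFree {m = m} valid , q-maximal {m = m} valid
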